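{- Let $A$ and $B$ be stable matching instances on workers $\mathcal{W}$ and firms $\mathcal{F}=\{f_1,\dots,f_n\}$ in which every worker has the same preference list in $A$ as in $B$. For $i=1,\dots,n$ let $B_i$ be the instance in which firm $f_i$ has its preference list from $B$ and every other agent has its preference list from $A$. Then $\mathcal{M}_A\cap\mathcal{M}_B=\mathcal{M}_A\cap\mathcal{M}_{B_1}\cap\mathcal{M}_{B_2}\cap\cdots\cap\mathcal{M}_{B_n}$.
   Context: In a stable matching instance each agent strictly totally orders the agents of the other side; a perfect matching $M$ is stable under $I$ if no pair $(w,f)\notin M$ has $w$ preferring $f$ to $M(w)$ and $f$ preferring $w$ to $M(f)$ under $I$; $\mathcal{M}_I$ is the set of perfect matchings stable under $I$. -}

module Defs where

open import Data.Nat using (ℕ)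
open import Data.Fin using (Fin; _<_)
open import Data.Product using (_×_)
open import Relation.Binary.PropositionalEquality using (_≡_)
open import Relation.Nullary using (¬_)
open import Function.Bundles using (_↔_; Inverse)

-- A strict total order on Fin k, given as a ranking bijection:
-- position 0 is the most preferred.
Pref : ℕ → Set
Pref k = Fin k ↔ Fin k

_≻[_]_ : ∀ {k} → Fin k → Pref k → Fin k → Set
x ≻[ p ] y = Inverse.to p x < Inverse.to p y

record Instance (m n : ℕ) : Set where
  field
    wpref : Fin m → Pref n
    fpref : Fin n → Pref m
open Instance public

Matching : ℕ → ℕ → Set
Matching m n = Fin m ↔ Fin n

partnerW : ∀ {m n} → Matching m n → Fin m → Fin n
partnerW M = Inverse.to M

partnerF : ∀ {m n} → Matching m n → Fin n → Fin m
partnerF M = Inverse.from M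

Blocking : ∀ {m n} → Instance m n → Matching m n → Fin m → Fin n → Set
Blocking I M w f =
  ¬ (partnerW M w ≡ f)
  × (f ≻[ wpref I w ] partnerW M w)
  × (w ≻[ fpref I f ] partnerF M f)

Stable : ∀ {m n} → Instance m n → Matching m n → Set
Stable I M = ∀ w f → ¬ Blocking I M w f

open import Data.Fin using (_≟_)
open import Relation.Nullary using (yes; no)

hybrid : ∀ {m n} → Instance m n → Instance m n → Fin n → Instance m n
hybrid A B i = record
  { wpref = wpref A
  ; fpref = λ f → if-firm (f ≟ i) (fpref B f) (fpref A f)
  }
  where
  if-firm : ∀ {P : Set} {X : Set} → Relation.Nullary.Dec P → X → X → X
  if-firm (yes _) x y = x
  if-firm (no _)  x y = y

SamePref : ∀ {k} → Pref k → Pref k → Set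
SamePref p q = ∀ x → Inverse.to p x ≡ Inverse.to q x

{-# OPTIONS --safe #-}
module Submission where

-- A blocking pair (w , f) depends only on the lists of w and f.  A pair blocking
-- some B_i is judged by A-lists except for firm f_i, which uses its B-list, so it
-- blocks A or B; conversely a pair (w , f) blocking B also blocks B_f, because
-- workers' lists agree in A and B.

open import Defs
open import Data.Empty using (⊥-elim)
open import Data.Fin using (_≟_; _<_)
open import Data.Product using (_×_; _,_)
open import Data.Sum using (_⊎_; inj₁; inj₂)
open import Function.Base using (_∘_)
open import Function.Bundles using (_⇔_; mk⇔)
open import Relation.Nullary using (yes; no)
open import Relation.Binary.PropositionalEquality using (_≡_; refl; sym; subst₂)

SamePref-sym : ∀ {k} (p q : Pref k) → SamePref p q → SamePref q p
SamePref-sym _ _ p≈q = sym ∘ p≈q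

≻-resp-SamePref : ∀ {k} (p q : Pref k) → SamePref p q →
                  ∀ {x y} → x ≻[ p ] y → x ≻[ q ] y
≻-resp-SamePref _ _ p≈q {x} {y} = subst₂ _<_ (p≈q x) (p≈q y)

Blocking-resp-SamePref : ∀ {m n} (I J : Instance m n) (M : Matching m n) {w f} →
                         SamePref (wpref I w) (wpref J w) →
                         SamePref (fpref I f) (fpref J f) →
                         Blocking I M w f → Blocking J M w f
Blocking-resp-SamePref I J _ {w} {f} w≈ f≈ (unmatched , w-prefers , f-prefers) =
  unmatched , ≻-resp-SamePref (wpref I w) (wpref J w) w≈ w-prefers
            , ≻-resp-SamePref (fpref I f) (fpref J f) f≈ f-prefers

module _ {m n} (A B : Instance m n) where

  hybrid-fpref-self : ∀ i → SamePref (fpref (hybrid A B i) i) (fpref B i)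
  hybrid-fpref-self i with i ≟ i
  ... | yes _  = λ _ → refl
  ... | no i≢i = ⊥-elim (i≢i refl)

  hybrid-fpref-other : ∀ i f → f ≡ i ⊎ SamePref (fpref (hybrid A B i) f) (fpref A f)
  hybrid-fpref-other i f with f ≟ i
  ... | yes f≡i = inj₁ f≡i
  ... | no _    = inj₂ λ _ → refl

  module _ (sameW : ∀ w → SamePref (wpref A w) (wpref B w)) (M : Matching m n) where

    Stable-hybrid : Stable A M → Stable B M → ∀ i → Stable (hybrid A B i) M
    Stable-hybrid stableA stableB i w f blocks with hybrid-fpref-other i f
    ... | inj₁ refl = stableB w f
      (Blocking-resp-SamePref (hybrid A B f) B M (sameW w) (hybrid-fpref-self f) blocks)
    ... | inj₂ f≈A  = stableA w f
      (Blocking-resp-SamePref (hybrid A B i) A M (λ _ → refl) f≈A blocks)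

    Stable-from-hybrids : (∀ i → Stable (hybrid A B i) M) → Stable B M
    Stable-from-hybrids stableᵢ w f blocks =
      stableᵢ f w f (Blocking-resp-SamePref B (hybrid A B f) M w≈ f≈ blocks)
      where
      w≈ : SamePref (wpref B w) (wpref A w)
      w≈ = SamePref-sym (wpref A w) (wpref B w) (sameW w)
      f≈ : SamePref (fpref B f) (fpref (hybrid A B f) f)
      f≈ = SamePref-sym (fpref (hybrid A B f) f) (fpref B f) (hybrid-fpref-self f)

theorem7 : ∀ {m n} (A B : Instance m n) →
    (∀ w → SamePref (wpref A w) (wpref B w)) →
    ∀ (M : Matching m n) →
    (Stable A M × Stable B M) ⇔ (Stable A M × (∀ i → Stable (hybrid A B i) M))
theorem7 A B sameW M = mk⇔
  (λ (stableA , stableB) → stableA , Stable-hybrid A B sameW M stableA stableB)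
  (λ (stableA , stableᵢ) → stableA , Stable-from-hybrids A B sameW M stableᵢ)
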